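{- Let $n\ge1$ and let $F\subseteq\mathcal{O}(\mathrm{GT}_n)$ be a non-empty face. Then $F=\bigcap_{(i,j)\in I}Q_{ij}$ for some $I\subseteq\mathrm{bad}_n$ if and only if $G(F)$ is a closed diamond poset.
   Context: $\mathrm{GT}_n$ is the poset on $\{(i,j)\in\mathbb{Z}^2:1\le j\le i\le n\}$ with $(i,j)\preceq(k,l)$ iff $k-i\le l-j$ and $j\le l$; its cover relations are $(i,j)\prec(i-1,j)$ and $(i,j)\prec(i+1,j+1)$. $\mathcal{O}(\mathrm{GT}_n)$ is the cone of order preserving maps $a:\mathrm{GT}_n\to\mathbb{R}$, $a_{i,j}=a(i,j)$. $\mathrm{bad}_n=\{(i,j):1\le j<i<n\}$; $Q_{ij}=\{a\in\mathcal{O}(\mathrm{GT}_n):a_{i,j}=a_{i,j+1}\}$ (an empty intersection over $I=\emptyset$ means $\mathcal{O}(\mathrm{GT}_n)$). For a face $F$, $G(F)$ is the set of cover relations $p\prec q$ of $\mathrm{GT}_n$ with $a(p)=a(q)$ for all $a\in F$ (viewed as a subposet/graph on $\mathrm{GT}_n$). For $(i,j)\in\mathrm{bad}_n$ the diamond $G_{ij}$ consists of the four cover relations $(i,j)\prec(i-1,j)$, $(i,j)\prec(i+1,j+1)$, $(i-1,j)\prec(i,j+1)$, $(i+1,j+1)\prec(i,j+1)$. A diamond poset is a set of cover relations that is a union of diamonds $G_{ij}$; it is closed if whenever $G_{i,j}\cup G_{i,j+1}\subseteq G$ then $G_{i-1,j}\cup G_{i+1,j+1}\subseteq G$.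
   Formalization: The order preserving maps forming $\mathcal{O}(\mathrm{GT}_n)$ take values in ℚ instead of ℝ, so its faces F and the sets $Q_{ij}$ consist of rational-valued maps. -}

module Defs where

open import Data.Nat using (ℕ; zero; suc; _+_; _∸_) renaming (_≤_ to _≤ℕ_; _<_ to _<ℕ_)
open import Data.Rational using (ℚ; 0ℚ; _≤_) renaming (_+_ to _+ℚ_; _*_ to _*ℚ_)
open import Data.Product using (Σ; ∃; ∃-syntax; _×_; _,_)
open import Data.Sum using (_⊎_)
open import Data.List using (List)
open import Data.List.Relation.Unary.All using (All)
open import Data.List.Membership.Propositional using (_∈_)
open import Relation.Binary.PropositionalEquality using (_≡_)
open import Function.Bundles using (_⇔_)

-- Points of GT_n are encoded as pairs (i , j) of naturals; a map
-- GT_n → ℚ is encoded as a function a : ℕ → ℕ → ℚ of which only the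
-- values at points of GT_n are ever inspected.
Pt : Set
Pt = ℕ × ℕ

Map : Set
Map = ℕ → ℕ → ℚ

InGT : ℕ → ℕ → ℕ → Set
InGT n i j = (1 ≤ℕ j) × (j ≤ℕ i) × (i ≤ℕ n)

-- (i,j) ⪯ (k,l)  iff  k - i ≤ l - j  and  j ≤ l   (k - i ≤ l - j  ⇔  k + j ≤ l + i)
Leq : ℕ → ℕ → ℕ → ℕ → Set
Leq i j k l = (k + j ≤ℕ l + i) × (j ≤ℕ l)

OrderPres : ℕ → Map → Set
OrderPres n a = ∀ i j k l → InGT n i j → InGT n k l → Leq i j k l → a i j ≤ a k l

Bad : ℕ → Pt → Set
Bad n (i , j) = (1 ≤ℕ j) × (j <ℕ i) × (i <ℕ n)

rowSum : Map → Map → ℕ → ℕ → ℚ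
rowSum w a i zero = 0ℚ
rowSum w a i (suc j) = rowSum w a i j +ℚ (w i (suc j) *ℚ a i (suc j))

pairing : ℕ → Map → Map → ℚ
pairing zero w a = 0ℚ
pairing (suc i) w a = pairing i w a +ℚ rowSum w a (suc i) (suc i)

IsFace : ℕ → (Map → Set) → Set
IsFace n F = Σ Map λ w →
  (∀ a → OrderPres n a → 0ℚ ≤ pairing n w a) ×
  (∀ a → F a ⇔ (OrderPres n a × pairing n w a ≡ 0ℚ))

NonEmpty : (Map → Set) → Set
NonEmpty F = ∃[ a ] F a

InQs : ℕ → List Pt → Map → Set
InQs n I a = OrderPres n a × All (λ p → a (Σ.proj₁ p) (Σ.proj₂ p) ≡ a (Σ.proj₁ p) (suc (Σ.proj₂ p))) I

Edge : Set
Edge = Pt × Pt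

Cover : ℕ → Edge → Set
Cover n ((i , j) , (k , l)) = InGT n i j × InGT n k l ×
  ((suc k ≡ i × l ≡ j) ⊎ (k ≡ suc i × l ≡ suc j))

G : ℕ → (Map → Set) → Edge → Set
G n F e@((i , j) , (k , l)) = Cover n e × (∀ a → F a → a i j ≡ a k l)

Diamond : Pt → Edge → Set
Diamond (i , j) e =
  (e ≡ ((i , j) , (i ∸ 1 , j))) ⊎
  (e ≡ ((i , j) , (suc i , suc j))) ⊎
  (e ≡ ((i ∸ 1 , j) , (i , suc j))) ⊎
  (e ≡ ((suc i , suc j) , (i , suc j)))

_⊆_ : (Edge → Set) → (Edge → Set) → Set
A ⊆ B = ∀ e → A e → B e

IsDiamondPoset : ℕ → (Edge → Set) → Set
IsDiamondPoset n H = Σ (List Pt) λ D →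
  All (Bad n) D × (∀ e → H e ⇔ (∃[ p ] (p ∈ D × Diamond p e)))

-- closedness: G_{i,j} ∪ G_{i,j+1} ⊆ G  ⇒  G_{i-1,j} ∪ G_{i+1,j+1} ⊆ G
-- (diamonds only exist for points of bad_n; G_{i+1,j+1} is required only when
--  (i+1,j+1) ∈ bad_n)
IsClosed : ℕ → (Edge → Set) → Set
IsClosed n H = ∀ i j → Bad n (i , j) → Bad n (i , suc j) →
  Diamond (i , j) ⊆ H → Diamond (i , suc j) ⊆ H →
  (Diamond (i ∸ 1 , j) ⊆ H) × (Bad n (suc i , suc j) → Diamond (suc i , suc j) ⊆ H)

IsClosedDiamondPoset : ℕ → (Edge → Set) → Set
IsClosedDiamondPoset n H = IsDiamondPoset n H × IsClosed n H

-- If F = ⋂_{p ∈ I} Q_p, then every a ∈ F with a_p = a_{p+(0,1)} is constant on the diamond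
-- G_p, and squeezing along four-element chains shows that G(F) is closed.  Which bad p have
-- a_p = a_{p+(0,1)} throughout F is seen on the 0/1 maps in F: thresholding any a ∈ F gives
-- the indicator of an up-set, described by monotone column heights (a cut), and such an
-- indicator lies in F iff the cut crosses no point of I.  Cuts are determined on bad points
-- by finitely many values, so D = {bad p crossed by no cut} is computable.  An edge of G(F)
-- on no diamond of D would be separated by a cut spliced from cuts crossing the two points
-- whose diamonds contain the edge; hence G(F) = ⋃_{p ∈ D} G_p.
-- Conversely, if G(F) = ⋃_{p ∈ D} G_p then F ⊆ ⋂_{p ∈ D} Q_p, and every order preserving
-- a ∈ ⋂_{p ∈ D} Q_p is constant along G(F), which for a face forces a ∈ F.

module Submission where

open import Defs
open import Data.Nat using (ℕ; zero; suc; z≤n; s≤s; _+_; _∸_; _⊓_; _≤_; _<_; _≤?_; _<?_)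
import Data.Nat.Properties as ℕ
open import Data.Rational using (ℚ; 0ℚ; 1ℚ; -_; 1/_; Positive; NonZero; positive; nonNegative)
  renaming (_+_ to _+ℚ_; _-_ to _-ℚ_; _*_ to _*ℚ_; _≤_ to _≤ℚ_; _<_ to _<ℚ_)
import Data.Rational.Properties as ℚ
open import Data.Rational.Solver using () renaming (module +-*-Solver to ℚ-Solver)
open import Data.Nat.Solver using () renaming (module +-*-Solver to ℕ-Solver)
open import Data.Product using (Σ; ∃; ∃-syntax; _×_; _,_; proj₁; proj₂)
open import Data.Product.Properties using (≡-dec)
open import Data.Sum using (_⊎_; inj₁; inj₂; [_,_]′)
open import Function using (id; _∘_)
open import Data.Empty using (⊥; ⊥-elim)
open import Relation.Binary.PropositionalEquality
open import Relation.Binary.Definitions using (Tri; tri<; tri≈; tri>)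
open import Data.List using (List; []; _∷_; upTo; cartesianProduct; filter)
open import Data.List.Membership.Propositional using (_∈_; lose; find)
open import Data.List.Membership.Propositional.Properties
  using (∈-cartesianProduct⁺; ∈-upTo⁺; ∈-filter⁺; ∈-filter⁻)
open import Data.List.Relation.Unary.Any as Any using (Any; here; there)
open import Data.List.Relation.Unary.All as All using (All)
open import Effect.Monad using (RawMonad)
open import Level using (0ℓ)
open import Function.Bundles using (_⇔_; Equivalence; mk⇔)
open import Relation.Nullary using (Dec; yes; no; ¬_)
open import Relation.Nullary.Decidable
  using (decidable-stable; ¬¬-excluded-middle; _⊎-dec_; _×-dec_; ¬?; map′)
open import Data.Fin using (Fin; toℕ; fromℕ<)
import Data.Fin.Properties as Fin
open import Data.Vec using (Vec; []; _∷_)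
open import Relation.Nullary.Negation using (¬¬-Monad; ¬¬-map; DoubleNegation)

-- Maps GT_n → ℚ as a vector space

infixl 6 _⊕_ _⊖_
infixl 7 _⊙_

_⊕_ : Map → Map → Map
(a ⊕ b) i j = a i j +ℚ b i j

_⊖_ : Map → Map → Map
(a ⊖ b) i j = a i j -ℚ b i j

_⊙_ : ℚ → Map → Map
(c ⊙ a) i j = c *ℚ a i j

0ᴹ : Map
0ᴹ _ _ = 0ℚ

module _ (w : Map) where
  open ℚ-Solver

  rowSum-⊕ : ∀ a b i j → rowSum w (a ⊕ b) i j ≡ rowSum w a i j +ℚ rowSum w b i j
  rowSum-⊕ a b i zero = refl
  rowSum-⊕ a b i (suc j) rewrite rowSum-⊕ a b i j =
    solve 5 (λ r s x y z → (r :+ s) :+ x :* (y :+ z) := (r :+ x :* y) :+ (s :+ x :* z)) refl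
      (rowSum w a i j) (rowSum w b i j) (w i (suc j)) (a i (suc j)) (b i (suc j))

  rowSum-⊖ : ∀ a b i j → rowSum w (a ⊖ b) i j ≡ rowSum w a i j -ℚ rowSum w b i j
  rowSum-⊖ a b i zero = refl
  rowSum-⊖ a b i (suc j) rewrite rowSum-⊖ a b i j =
    solve 5 (λ r s x y z → (r :- s) :+ x :* (y :- z) := (r :+ x :* y) :- (s :+ x :* z)) refl
      (rowSum w a i j) (rowSum w b i j) (w i (suc j)) (a i (suc j)) (b i (suc j))

  rowSum-⊙ : ∀ c a i j → rowSum w (c ⊙ a) i j ≡ c *ℚ rowSum w a i j
  rowSum-⊙ c a i zero = sym (ℚ.*-zeroʳ c)
  rowSum-⊙ c a i (suc j) rewrite rowSum-⊙ c a i j =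
    solve 4 (λ c r x y → c :* r :+ x :* (c :* y) := c :* (r :+ x :* y)) refl
      c (rowSum w a i j) (w i (suc j)) (a i (suc j))

  rowSum-0ᴹ : ∀ i j → rowSum w 0ᴹ i j ≡ 0ℚ
  rowSum-0ᴹ i zero = refl
  rowSum-0ᴹ i (suc j) rewrite rowSum-0ᴹ i j =
    solve 1 (λ x → con 0ℚ :+ x :* con 0ℚ := con 0ℚ) refl (w i (suc j))

  pairing-⊕ : ∀ n a b → pairing n w (a ⊕ b) ≡ pairing n w a +ℚ pairing n w b
  pairing-⊕ zero a b = refl
  pairing-⊕ (suc n) a b rewrite pairing-⊕ n a b | rowSum-⊕ a b (suc n) (suc n) =
    solve 4 (λ p q r s → (p :+ q) :+ (r :+ s) := (p :+ r) :+ (q :+ s)) refl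
      (pairing n w a) (pairing n w b) (rowSum w a (suc n) (suc n)) (rowSum w b (suc n) (suc n))

  pairing-⊖ : ∀ n a b → pairing n w (a ⊖ b) ≡ pairing n w a -ℚ pairing n w b
  pairing-⊖ zero a b = refl
  pairing-⊖ (suc n) a b rewrite pairing-⊖ n a b | rowSum-⊖ a b (suc n) (suc n) =
    solve 4 (λ p q r s → (p :- q) :+ (r :- s) := (p :+ r) :- (q :+ s)) refl
      (pairing n w a) (pairing n w b) (rowSum w a (suc n) (suc n)) (rowSum w b (suc n) (suc n))

  pairing-⊙ : ∀ n c a → pairing n w (c ⊙ a) ≡ c *ℚ pairing n w a
  pairing-⊙ zero c a = sym (ℚ.*-zeroʳ c)
  pairing-⊙ (suc n) c a rewrite pairing-⊙ n c a | rowSum-⊙ c a (suc n) (suc n) =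
    solve 3 (λ c p r → c :* p :+ c :* r := c :* (p :+ r)) refl
      c (pairing n w a) (rowSum w a (suc n) (suc n))

  pairing-0ᴹ : ∀ n → pairing n w 0ᴹ ≡ 0ℚ
  pairing-0ᴹ zero = refl
  pairing-0ᴹ (suc n) rewrite pairing-0ᴹ n | rowSum-0ᴹ (suc n) (suc n) = refl

Leq-column : ∀ {i k} j → k ≤ i → Leq i j k j
Leq-column {i} j k≤i = ℕ.≤-trans (ℕ.+-monoˡ-≤ j k≤i) (ℕ.≤-reflexive (ℕ.+-comm i j)) , ℕ.≤-refl

Leq-up : ∀ i j → Leq (suc i) j i j
Leq-up i j = Leq-column j (ℕ.n≤1+n i)

Leq-diag : ∀ i j → Leq i j (suc i) (suc j)
Leq-diag i j = s≤s (ℕ.≤-reflexive (ℕ.+-comm i j)) , ℕ.n≤1+n j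

Leq-right : ∀ i j → Leq i j i (suc j)
Leq-right i j = ℕ.≤-trans (ℕ.≤-reflexive (ℕ.+-comm i j)) (ℕ.n≤1+n _) , ℕ.n≤1+n j

cover⇒Leq : ∀ {n i j k l} → Cover n ((i , j) , (k , l)) → Leq i j k l
cover⇒Leq (_ , _ , inj₁ (refl , refl)) = Leq-up _ _
cover⇒Leq (_ , _ , inj₂ (refl , refl)) = Leq-diag _ _

m≤n⇒∃[o]o+m≡n : ∀ {m n} → m ≤ n → ∃ λ o → o + m ≡ n
m≤n⇒∃[o]o+m≡n {m} {n} m≤n = n ∸ m , ℕ.m∸n+n≡m m≤n

CoverMonotone : ℕ → Map → Set
CoverMonotone n a = ∀ {i j k l} → Cover n ((i , j) , (k , l)) → a i j ≤ℚ a k l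

orderPres⇒coverMonotone : ∀ {n a} → OrderPres n a → CoverMonotone n a
orderPres⇒coverMonotone op c@(p , q , _) = op _ _ _ _ p q (cover⇒Leq c)

module _ {n : ℕ} {a : Map} (mono : CoverMonotone n a) where

  up-chain : ∀ d {i j} → 1 ≤ j → j ≤ i → d + i ≤ n → a (d + i) j ≤ℚ a i j
  up-chain zero _ _ _ = ℚ.≤-refl
  up-chain (suc d) {i} 1≤j j≤i 1+d+i≤n = ℚ.≤-trans (mono step) (up-chain d 1≤j j≤i d+i≤n)
    where
    d+i≤n = ℕ.≤-trans (ℕ.n≤1+n _) 1+d+i≤n
    j≤d+i = ℕ.≤-trans j≤i (ℕ.m≤n+m i d)
    step : Cover n ((suc (d + i) , _) , (d + i , _))
    step = (1≤j , ℕ.≤-trans j≤d+i (ℕ.n≤1+n _) , 1+d+i≤n) , (1≤j , j≤d+i , d+i≤n) , inj₁ (refl , refl)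

  diag-chain : ∀ d {i j} → 1 ≤ j → j ≤ i → d + i ≤ n → a i j ≤ℚ a (d + i) (d + j)
  diag-chain zero _ _ _ = ℚ.≤-refl
  diag-chain (suc d) {i} {j} 1≤j j≤i 1+d+i≤n = ℚ.≤-trans (diag-chain d 1≤j j≤i d+i≤n) (mono step)
    where
    d+i≤n = ℕ.≤-trans (ℕ.n≤1+n _) 1+d+i≤n
    step : Cover n ((d + i , d + j) , (suc (d + i) , suc (d + j)))
    step = (ℕ.≤-trans 1≤j (ℕ.m≤n+m j d) , ℕ.+-monoʳ-≤ d j≤i , d+i≤n)
         , (s≤s z≤n , s≤s (ℕ.+-monoʳ-≤ d j≤i) , 1+d+i≤n)
         , inj₂ (refl , refl)

  -- Every comparable pair is joined by a path that first goes up, then diagonally.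
  coverMonotone⇒orderPres : OrderPres n a
  coverMonotone⇒orderPres i j k l (1≤j , j≤i , i≤n) (_ , l≤k , k≤n) (k+j≤l+i , j≤l)
    with e , refl ← m≤n⇒∃[o]o+m≡n j≤l | f , refl ← m≤n⇒∃[o]o+m≡n l≤k = path (m≤n⇒∃[o]o+m≡n f+j≤i)
    where
    open ℕ-Solver
    f+j≤i : f + j ≤ i
    f+j≤i = ℕ.+-cancelˡ-≤ (e + j) (f + j) i (ℕ.≤-trans (ℕ.≤-reflexive
              (solve 3 (λ e f j → (e :+ j) :+ (f :+ j) := (f :+ (e :+ j)) :+ j) refl e f j)) k+j≤l+i)
    swap : e + (f + j) ≡ f + (e + j)
    swap = solve 3 (λ e f j → e :+ (f :+ j) := f :+ (e :+ j)) refl e f j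
    path : (∃ λ d → d + (f + j) ≡ i) → a i j ≤ℚ a (f + (e + j)) (e + j)
    path (d , refl) = ℚ.≤-trans (up-chain d 1≤j (ℕ.m≤n+m j f) i≤n)
      (subst (λ x → a (f + j) j ≤ℚ a x (e + j)) swap
        (diag-chain e 1≤j (ℕ.m≤n+m j f) (subst (_≤ n) (sym swap) k≤n)))

bad⇒InGT : ∀ {n i j} → Bad n (i , j) → InGT n i j
bad⇒InGT (1≤j , j<i , i<n) = 1≤j , ℕ.<⇒≤ j<i , ℕ.<⇒≤ i<n

bad⇒InGT-right : ∀ {n i j} → Bad n (i , j) → InGT n i (suc j)
bad⇒InGT-right (_ , j<i , i<n) = s≤s z≤n , j<i , ℕ.<⇒≤ i<n

bad? : ∀ n p → Dec (Bad n p)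
bad? n (i , j) = (1 ≤? j) ×-dec (j <? i) ×-dec (i <? n)

points : ℕ → List Pt
points n = cartesianProduct (upTo (suc n)) (upTo (suc n))

InGT⇒∈points : ∀ {n i j} → InGT n i j → (i , j) ∈ points n
InGT⇒∈points (_ , j≤i , i≤n) = ∈-cartesianProduct⁺ (∈-upTo⁺ (s≤s i≤n)) (∈-upTo⁺ (s≤s (ℕ.≤-trans j≤i i≤n)))

edges : ℕ → List Edge
edges n = cartesianProduct (points n) (points n)

cover⇒∈edges : ∀ {n e} → Cover n e → e ∈ edges n
cover⇒∈edges (p , q , _) = ∈-cartesianProduct⁺ (InGT⇒∈points p) (InGT⇒∈points q)

-- Diamonds and G(F)

Flat : Map → Edge → Set
Flat a ((i , j) , (k , l)) = a i j ≡ a k l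

InQ : Map → Pt → Set
InQ a (i , j) = a i j ≡ a i (suc j)

≤-squeeze : ∀ {x y z : ℚ} → x ≤ℚ y → y ≤ℚ z → x ≡ z → x ≡ y × y ≡ z
≤-squeeze x≤y y≤z refl = ℚ.≤-antisym x≤y y≤z , ℚ.≤-antisym y≤z x≤y

≤-squeeze-middle : ∀ {x y z t : ℚ} → x ≤ℚ y → y ≤ℚ z → z ≤ℚ t → x ≡ t → y ≡ z
≤-squeeze-middle x≤y y≤z z≤t refl = ℚ.≤-antisym y≤z (ℚ.≤-trans z≤t x≤y)

module DiamondCorners {n i j} (bad : Bad n (suc i , j)) where

  bottom : InGT n (suc i) j
  bottom = bad⇒InGT bad

  top : InGT n (suc i) (suc j)
  top = bad⇒InGT-right bad

  left : InGT n i j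
  left = let (1≤j , j<1+i , 1+i<n) = bad in 1≤j , ℕ.≤-pred j<1+i , ℕ.<⇒≤ (ℕ.<-trans (ℕ.n<1+n i) 1+i<n)

  right : InGT n (suc (suc i)) (suc j)
  right = let (_ , j<1+i , 1+i<n) = bad in s≤s z≤n , s≤s (ℕ.<⇒≤ j<1+i) , 1+i<n

diamond-cover : ∀ {n p e} → Bad n p → Diamond p e → Cover n e
diamond-cover {p = zero , _} (_ , () , _)
diamond-cover {p = suc i , j} bad d = edge d
  where
  open DiamondCorners bad
  edge : ∀ {e} → Diamond (suc i , j) e → Cover _ e
  edge (inj₁ refl)                = bottom , left , inj₁ (refl , refl)
  edge (inj₂ (inj₁ refl))         = bottom , right , inj₂ (refl , refl)
  edge (inj₂ (inj₂ (inj₁ refl)))  = left , top , inj₂ (refl , refl)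
  edge (inj₂ (inj₂ (inj₂ refl)))  = right , top , inj₁ (refl , refl)

diamond-flat : ∀ {n a p e} → OrderPres n a → Bad n p → InQ a p → Diamond p e → Flat a e
diamond-flat {p = zero , _} _ (_ , () , _)
diamond-flat {n} {a} {suc i , j} op bad eq d = edge d
  where
  open DiamondCorners bad
  via-left = ≤-squeeze (op _ _ _ _ bottom left (Leq-up i j)) (op _ _ _ _ left top (Leq-diag i j)) eq
  via-right = ≤-squeeze (op _ _ _ _ bottom right (Leq-diag (suc i) j))
                        (op _ _ _ _ right top (Leq-up (suc i) (suc j))) eq
  edge : ∀ {e} → Diamond (suc i , j) e → Flat a e
  edge (inj₁ refl)                = proj₁ via-left
  edge (inj₂ (inj₁ refl))         = proj₁ via-right
  edge (inj₂ (inj₂ (inj₁ refl)))  = proj₂ via-left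
  edge (inj₂ (inj₂ (inj₂ refl)))  = proj₂ via-right

diamond? : ∀ p e → Dec (Diamond p e)
diamond? (i , j) e = e ≟ _ ⊎-dec e ≟ _ ⊎-dec e ≟ _ ⊎-dec e ≟ _
  where
  _≟_ : (e e′ : Edge) → Dec (e ≡ e′)
  _≟_ = ≡-dec (≡-dec ℕ._≟_ ℕ._≟_) (≡-dec ℕ._≟_ ℕ._≟_)

module _ {n : ℕ} {F : Map → Set} where

  diamond⊆G⇒InQ : ∀ {p} → Diamond p ⊆ G n F → ∀ a → F a → InQ a p
  diamond⊆G⇒InQ sub a Fa =
    trans (proj₂ (sub _ (inj₁ refl)) a Fa) (proj₂ (sub _ (inj₂ (inj₂ (inj₁ refl)))) a Fa)

  module _ (F⊆O : ∀ a → F a → OrderPres n a) where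

    InQ⇒diamond⊆G : ∀ {p} → Bad n p → (∀ a → F a → InQ a p) → Diamond p ⊆ G n F
    InQ⇒diamond⊆G bad eq e d = diamond-cover bad d , λ a Fa → diamond-flat (F⊆O a Fa) bad (eq a Fa) d

    -- The bottom and top of each new diamond lie on a chain from (i , j) to (i , j + 2),
    -- whose ends agree on F.
    G-closed : IsClosed n (G n F)
    G-closed zero _ (_ , () , _)
    G-closed (suc i) j bad₀ bad₁ sub₀ sub₁ =
      InQ⇒diamond⊆G badˡ (λ a Fa → ≤-squeeze-middle
          (op a Fa (bad⇒InGT bad₀) (bad⇒InGT badˡ) (Leq-up i j))
          (op a Fa (bad⇒InGT badˡ) (bad⇒InGT-right badˡ) (Leq-right i j))
          (op a Fa (bad⇒InGT-right badˡ) (bad⇒InGT-right bad₁) (Leq-diag i (suc j)))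
          (outer a Fa)) ,
      λ badʳ → InQ⇒diamond⊆G badʳ (λ a Fa → ≤-squeeze-middle
          (op a Fa (bad⇒InGT bad₀) (bad⇒InGT badʳ) (Leq-diag (suc i) j))
          (op a Fa (bad⇒InGT badʳ) (bad⇒InGT-right badʳ) (Leq-right (suc (suc i)) (suc j)))
          (op a Fa (bad⇒InGT-right badʳ) (bad⇒InGT-right bad₁) (Leq-up (suc i) (suc (suc j))))
          (outer a Fa))
      where
      op : ∀ a → F a → ∀ {i j k l} → InGT n i j → InGT n k l → Leq i j k l → a i j ≤ℚ a k l
      op a Fa = F⊆O a Fa _ _ _ _
      badˡ : Bad n (i , j)
      badˡ = let (1≤j , _ , 1+i<n) = bad₀ ; (_ , 2+j≤1+i , _) = bad₁ in
             1≤j , ℕ.≤-pred 2+j≤1+i , ℕ.<-trans (ℕ.n<1+n i) 1+i<n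
      outer : ∀ a → F a → a (suc i) j ≡ a (suc i) (suc (suc j))
      outer a Fa = trans (diamond⊆G⇒InQ sub₀ a Fa) (diamond⊆G⇒InQ sub₁ a Fa)

-- Faces of O(GT_n)

p≤q⇒0≤q-p : ∀ {p q} → p ≤ℚ q → 0ℚ ≤ℚ q -ℚ p
p≤q⇒0≤q-p {p} {q} p≤q = subst (_≤ℚ q -ℚ p) (ℚ.+-inverseʳ p) (ℚ.+-monoˡ-≤ (- p) p≤q)

0≤q-p⇒p≤q : ∀ {p q} → 0ℚ ≤ℚ q -ℚ p → p ≤ℚ q
0≤q-p⇒p≤q {p} {q} 0≤q-p = subst₂ _≤ℚ_ (ℚ.+-identityˡ p)
  (solve 2 (λ p q → (q :- p) :+ p := q) refl p q) (ℚ.+-monoˡ-≤ p 0≤q-p)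
  where open ℚ-Solver

q-p≡0⇒q≡p : ∀ {p q} → q -ℚ p ≡ 0ℚ → q ≡ p
q-p≡0⇒q≡p {p} {q} q-p≡0 = begin
  q              ≡⟨ solve 2 (λ p q → q := (q :- p) :+ p) refl p q ⟩
  (q -ℚ p) +ℚ p  ≡⟨ cong (_+ℚ p) q-p≡0 ⟩
  0ℚ +ℚ p        ≡⟨ ℚ.+-identityˡ p ⟩
  p              ∎
  where open ℚ-Solver; open ≡-Reasoning

nonNeg-quotient : ∀ {c d} → 0ℚ ≤ℚ c → 0ℚ <ℚ d → ∃ λ r → 0ℚ ≤ℚ r × r *ℚ d ≡ c
nonNeg-quotient {c} {d} 0≤c 0<d = c *ℚ d⁻¹ , 0≤r , r*d≡c
  where
  instance
    d-pos : Positive d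
    d-pos = positive 0<d
    d-nonZero : NonZero d
    d-nonZero = ℚ.pos⇒nonZero d
  d⁻¹ = 1/ d
  0≤r : 0ℚ ≤ℚ c *ℚ d⁻¹
  0≤r = ℚ.nonNegative⁻¹ _ {{ℚ.nonNeg*nonNeg⇒nonNeg c {{nonNegative 0≤c}} d⁻¹
          {{ℚ.pos⇒nonNeg d⁻¹ {{ℚ.1/pos⇒pos d}}}}}}
  r*d≡c : c *ℚ d⁻¹ *ℚ d ≡ c
  r*d≡c = trans (ℚ.*-assoc c d⁻¹ d) (trans (cong (c *ℚ_) (ℚ.*-inverseˡ d)) (ℚ.*-identityʳ c))

slope : Map → Edge → ℚ
slope a ((i , j) , (k , l)) = a k l -ℚ a i j

slope-⊕ : ∀ a b e → slope (a ⊕ b) e ≡ slope a e +ℚ slope b e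
slope-⊕ a b ((i , j) , (k , l)) =
  solve 4 (λ x y u v → (u :+ v) :- (x :+ y) := (u :- x) :+ (v :- y)) refl (a i j) (b i j) (a k l) (b k l)
  where open ℚ-Solver

slope-⊖ : ∀ a b e → slope (a ⊖ b) e ≡ slope a e -ℚ slope b e
slope-⊖ a b ((i , j) , (k , l)) =
  solve 4 (λ x y u v → (u :- v) :- (x :- y) := (u :- x) :- (v :- y)) refl (a i j) (b i j) (a k l) (b k l)
  where open ℚ-Solver

module Face {n : ℕ} {F : Map → Set} (face : IsFace n F) where

  private
    w = proj₁ face

  face⇔ : ∀ a → F a ⇔ (OrderPres n a × pairing n w a ≡ 0ℚ)
  face⇔ = proj₂ (proj₂ face)

  face⊆O : ∀ a → F a → OrderPres n a
  face⊆O a Fa = proj₁ (Equivalence.to (face⇔ a) Fa)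

  private
    pairing-nonNeg : ∀ a → OrderPres n a → 0ℚ ≤ℚ pairing n w a
    pairing-nonNeg = proj₁ (proj₂ face)

    pairing≡0 : ∀ {a} → F a → pairing n w a ≡ 0ℚ
    pairing≡0 {a} Fa = proj₂ (Equivalence.to (face⇔ a) Fa)

    slope-nonNeg : ∀ {a e} → F a → Cover n e → 0ℚ ≤ℚ slope a e
    slope-nonNeg {a} Fa c = p≤q⇒0≤q-p (orderPres⇒coverMonotone (face⊆O a Fa) c)

  F-0ᴹ : F 0ᴹ
  F-0ᴹ = Equivalence.from (face⇔ 0ᴹ) ((λ _ _ _ _ _ _ _ → ℚ.≤-refl) , pairing-0ᴹ w n)

  F-⊕ : ∀ {a b} → F a → F b → F (a ⊕ b)
  F-⊕ {a} {b} Fa Fb = Equivalence.from (face⇔ (a ⊕ b))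
    ( (λ i j k l p q le → ℚ.+-mono-≤ (face⊆O a Fa i j k l p q le) (face⊆O b Fb i j k l p q le))
    , trans (pairing-⊕ w n a b) (cong₂ _+ℚ_ (pairing≡0 Fa) (pairing≡0 Fb)) )

  F-⊙ : ∀ {c a} → 0ℚ ≤ℚ c → F a → F (c ⊙ a)
  F-⊙ {c} {a} 0≤c Fa = Equivalence.from (face⇔ (c ⊙ a))
    ( (λ i j k l p q le → ℚ.*-monoˡ-≤-nonNeg c {{nonNegative 0≤c}} (face⊆O a Fa i j k l p q le))
    , trans (pairing-⊙ w n c a) (trans (cong (c *ℚ_) (pairing≡0 Fa)) (ℚ.*-zeroʳ c)) )

  -- Fix a ∈ O(GT_n) constant along G(F).  Summing, over all covers e, an element of F whose
  -- slope on e equals that of a gives B ∈ F with B - a ∈ O(GT_n); then 0 ≤ ⟨w,B-a⟩ = -⟨w,a⟩.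
  module _ {a : Map} (a∈O : OrderPres n a) (a-flat : ∀ e → G n F e → Flat a e) where

    open RawMonad (¬¬-Monad {0ℓ})

    matching : ∀ {e} → Cover n e → DoubleNegation (Σ Map λ b → F b × slope b e ≡ slope a e)
    matching {e@((i , j) , (k , l))} c = do
      no e∉G ← ¬¬-excluded-middle {A = G n F e}
        where yes e∈G → pure (0ᴹ , F-0ᴹ , trans (ℚ.+-inverseʳ 0ℚ) (sym (flat⇒slope≡0 (a-flat e e∈G))))
      (b , Fb , b-steep) ← nonFlat e∉G
      let (r , 0≤r , r*d≡c) = nonNeg-quotient (p≤q⇒0≤q-p (orderPres⇒coverMonotone a∈O c))
                                 (steep b Fb b-steep)
      pure (r ⊙ b , F-⊙ 0≤r Fb ,
            trans (solve 3 (λ r x y → r :* x :- r :* y := r :* (x :- y)) refl r (b k l) (b i j)) r*d≡c)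
      where
      open ℚ-Solver
      flat⇒slope≡0 : ∀ {x y} → x ≡ y → y -ℚ x ≡ 0ℚ
      flat⇒slope≡0 {x} refl = ℚ.+-inverseʳ x
      nonFlat : ¬ G n F e → DoubleNegation (Σ Map λ b → F b × b i j ≢ b k l)
      nonFlat e∉G noWitness =
        e∉G (c , λ b Fb → decidable-stable (b i j ℚ.≟ b k l) (λ ne → noWitness (b , Fb , ne)))
      steep : ∀ b → F b → b i j ≢ b k l → 0ℚ <ℚ b k l -ℚ b i j
      steep b Fb ne = ℚ.≰⇒> λ d≤0 → ne (sym (q-p≡0⇒q≡p (ℚ.≤-antisym d≤0 (slope-nonNeg Fb c))))

    Dominating : List Edge → Set
    Dominating es = Σ Map λ B → F B × (∀ {e} → e ∈ es → Cover n e → 0ℚ ≤ℚ slope (B ⊖ a) e)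

    dominating : ∀ es → DoubleNegation (Dominating es)
    dominating [] = pure (0ᴹ , F-0ᴹ , λ ())
    dominating (e ∷ es) = do
      (B , FB , dom) ← dominating es
      yes c ← ¬¬-excluded-middle {A = Cover n e}
        where no ¬c → pure (B , FB , λ { (here refl) c → ⊥-elim (¬c c) ; (there m) → dom m })
      (b , Fb , b-matches) ← matching c
      pure (B ⊕ b , F-⊕ FB Fb , λ where
        (here refl) _ → subst (0ℚ ≤ℚ_) (sym (new B b e b-matches)) (slope-nonNeg FB c)
        {e′} (there m) c′ → subst (0ℚ ≤ℚ_) (sym (old B b e′))
          (subst (_≤ℚ slope (B ⊖ a) e′ +ℚ slope b e′) (ℚ.+-identityˡ 0ℚ)
            (ℚ.+-mono-≤ (dom m c′) (slope-nonNeg Fb c′))))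
      where
      open ℚ-Solver
      old : ∀ B b e → slope ((B ⊕ b) ⊖ a) e ≡ slope (B ⊖ a) e +ℚ slope b e
      old B b e = begin
        slope ((B ⊕ b) ⊖ a) e                    ≡⟨ slope-⊖ (B ⊕ b) a e ⟩
        slope (B ⊕ b) e -ℚ slope a e             ≡⟨ cong (_-ℚ slope a e) (slope-⊕ B b e) ⟩
        slope B e +ℚ slope b e -ℚ slope a e      ≡⟨ solve 3 (λ x y z → x :+ y :- z := (x :- z) :+ y) refl
                                                       (slope B e) (slope b e) (slope a e) ⟩
        slope B e -ℚ slope a e +ℚ slope b e      ≡⟨ cong (_+ℚ slope b e) (sym (slope-⊖ B a e)) ⟩
        slope (B ⊖ a) e +ℚ slope b e             ∎
        where open ≡-Reasoning
      new : ∀ B b e → slope b e ≡ slope a e → slope ((B ⊕ b) ⊖ a) e ≡ slope B e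
      new B b e same = begin
        slope ((B ⊕ b) ⊖ a) e                    ≡⟨ old B b e ⟩
        slope (B ⊖ a) e +ℚ slope b e             ≡⟨ cong₂ _+ℚ_ (slope-⊖ B a e) same ⟩
        slope B e -ℚ slope a e +ℚ slope a e      ≡⟨ solve 2 (λ x z → x :- z :+ z := x) refl
                                                       (slope B e) (slope a e) ⟩
        slope B e                                ∎
        where open ≡-Reasoning

    flat-on-G⇒∈F : F a
    flat-on-G⇒∈F = Equivalence.from (face⇔ a)
      (a∈O , decidable-stable (pairing n w a ℚ.≟ 0ℚ) (¬¬-map conclude (dominating (edges n))))
      where
      conclude : Dominating (edges n) → pairing n w a ≡ 0ℚ
      conclude (B , FB , dom) = ℚ.≤-antisym ⟨w,a⟩≤0 (pairing-nonNeg a a∈O)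
        where
        B-a∈O : OrderPres n (B ⊖ a)
        B-a∈O = coverMonotone⇒orderPres (λ c → 0≤q-p⇒p≤q (dom (cover⇒∈edges c) c))
        ⟨w,a⟩≤0 : pairing n w a ≤ℚ 0ℚ
        ⟨w,a⟩≤0 = 0≤q-p⇒p≤q (subst (0ℚ ≤ℚ_)
          (trans (pairing-⊖ w n B a) (cong (_-ℚ pairing n w a) (pairing≡0 FB)))
          (pairing-nonNeg (B ⊖ a) B-a∈O))

-- Cuts: the up-sets of GT_n, and the 0/1 maps they define

StepMonotone : (ℕ → ℕ) → Set
StepMonotone g = ∀ m → g m ≤ g (suc m)

stepMonotone⇒monotone : ∀ {g} → StepMonotone g → ∀ {m o} → m ≤ o → g m ≤ g o
stepMonotone⇒monotone {g} step {m} m≤o with d , refl ← m≤n⇒∃[o]o+m≡n m≤o = go d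
  where
  go : ∀ d → g m ≤ g (d + m)
  go zero    = ℕ.≤-refl
  go (suc d) = ℕ.≤-trans (go d) (step (d + m))

-- A monotone g : ℕ → ℕ describes the up-set of GT_n whose column j consists of the
-- points (i , j) with i < g j + j, i.e. the top g j points of the column.
Above : (ℕ → ℕ) → Pt → Set
Above g (i , j) = i < g j + j

Crosses : (ℕ → ℕ) → Pt → Set
Crosses g (i , j) = g j + j ≤ i × i ≤ g (suc j) + j

Crosses⇔ : ∀ {g i j} → Crosses g (i , j) ⇔ (¬ Above g (i , j) × Above g (i , suc j))
Crosses⇔ {g} {i} {j} = mk⇔
  (λ (gj+j≤i , i≤g[1+j]+j) → ℕ.≤⇒≯ gj+j≤i , ℕ.≤-trans (s≤s i≤g[1+j]+j) (ℕ.≤-reflexive (sym +-suc′)))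
  (λ (¬above , above′) → ℕ.≮⇒≥ ¬above , ℕ.≤-pred (ℕ.≤-trans above′ (ℕ.≤-reflexive +-suc′)))
  where
  +-suc′ : g (suc j) + suc j ≡ suc (g (suc j) + j)
  +-suc′ = ℕ.+-suc (g (suc j)) j

Above-upward : ∀ {g} → StepMonotone g → ∀ {i j k l} → Leq i j k l → Above g (i , j) → Above g (k , l)
Above-upward {g} mono {i} {j} {k} {l} (k+j≤l+i , j≤l) i<gj+j = ℕ.+-cancelʳ-≤ j (suc k) (g l + l) (begin
  suc (k + j)      ≤⟨ s≤s k+j≤l+i ⟩
  suc (l + i)      ≡⟨ sym (ℕ.+-suc l i) ⟩
  l + suc i        ≤⟨ ℕ.+-monoʳ-≤ l i<gj+j ⟩
  l + (g j + j)    ≤⟨ ℕ.+-monoʳ-≤ l (ℕ.+-monoˡ-≤ j (stepMonotone⇒monotone mono j≤l)) ⟩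
  l + (g l + j)    ≡⟨ solve 3 (λ l x j → l :+ (x :+ j) := (x :+ l) :+ j) refl l (g l) j ⟩
  g l + l + j      ∎)
  where open ℕ.≤-Reasoning; open ℕ-Solver

indicator : ∀ {P : Set} → Dec P → ℚ
indicator (yes _) = 1ℚ
indicator (no _) = 0ℚ

indicator-mono : ∀ {P Q : Set} (p : Dec P) (q : Dec Q) → (P → Q) → indicator p ≤ℚ indicator q
indicator-mono (yes _) (yes _) _   = ℚ.≤-refl
indicator-mono (yes p) (no ¬q) p⇒q = ⊥-elim (¬q (p⇒q p))
indicator-mono (no _)  (yes _) _   = ℚ.<⇒≤ (ℚ.positive⁻¹ 1ℚ)
indicator-mono (no _)  (no _)  _   = ℚ.≤-refl

indicator-≢ : ∀ {P Q : Set} (p : Dec P) (q : Dec Q) → ¬ P → Q → indicator p ≢ indicator q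
indicator-≢ (yes p) _       ¬p _ = ⊥-elim (¬p p)
indicator-≢ (no _)  (no ¬q) _  q = ⊥-elim (¬q q)
indicator-≢ (no _)  (yes _) _  _ = λ ()

cutMap : (ℕ → ℕ) → Map
cutMap g i j = indicator (i <? g j + j)

cutMap-orderPres : ∀ {n g} → StepMonotone g → OrderPres n (cutMap g)
cutMap-orderPres {g = g} mono i j k l _ _ le =
  indicator-mono (i <? g j + j) (k <? g l + l) (Above-upward mono le)

cutMap-InQ : ∀ {g} → StepMonotone g → ∀ {p} → ¬ Crosses g p → InQ (cutMap g) p
cutMap-InQ {g} mono {i , j} ¬crosses with i <? g j + j | i <? g (suc j) + suc j
... | yes _ | yes _ = refl
... | no _  | no _  = refl
... | yes above | no ¬above′ = ⊥-elim (¬above′ (Above-upward mono (Leq-right i j) above))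
... | no ¬above | yes above′ = ⊥-elim (¬crosses (Equivalence.from (Crosses⇔ {g}) (¬above , above′)))

cutMap-separates : ∀ g {i j k l} → ¬ Above g (i , j) → Above g (k , l) → cutMap g i j ≢ cutMap g k l
cutMap-separates g {i} {j} {k} {l} = indicator-≢ (i <? g j + j) (k <? g l + l)

record Cut (I : List Pt) : Set where
  field
    height   : ℕ → ℕ
    monotone : StepMonotone height
    avoids   : All (λ p → ¬ Crosses height p) I

open Cut

CrossingCut : List Pt → Pt → Set
CrossingCut I p = Σ (Cut I) λ c → Crosses (height c) p

cutMap∈Qs : ∀ {n I} (c : Cut I) → InQs n I (cutMap (height c))
cutMap∈Qs c = cutMap-orderPres (monotone c) , All.map (cutMap-InQ (monotone c)) (avoids c)

prefixLength : {P : ℕ → Set} → (∀ y → Dec (P y)) → ℕ → ℕ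
prefixLength P? zero = 0
prefixLength P? (suc N) with P? 0
... | yes _ = suc (prefixLength (λ y → P? (suc y)) N)
... | no _  = 0

prefixLength-sound : ∀ {P : ℕ → Set} (P? : ∀ y → Dec (P y)) N {y} → y < prefixLength P? N → P y
prefixLength-sound P? (suc N) {y} lt with P? 0
prefixLength-sound     P? (suc N) {zero}  _        | yes p0 = p0
prefixLength-sound {P} P? (suc N) {suc y} (s≤s lt) | yes _  =
  prefixLength-sound {λ y → P (suc y)} (λ y → P? (suc y)) N lt

prefixLength-complete : ∀ {P : ℕ → Set} (P? : ∀ y → Dec (P y)) {N y} → y < N → (∀ {y′} → y′ ≤ y → P y′) →
                        y < prefixLength P? N
prefixLength-complete P? {suc N} {y} y<N all with P? 0
... | no ¬p0 = ⊥-elim (¬p0 (all z≤n))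
prefixLength-complete P? {suc N} {zero}  _         _   | yes _ = s≤s z≤n
prefixLength-complete {P} P? {suc N} {suc y} (s≤s y<N) all | yes _ =
  s≤s (prefixLength-complete {λ y → P (suc y)} (λ y → P? (suc y)) y<N (λ y′≤y → all (s≤s y′≤y)))

prefixLength-mono : ∀ {P Q : ℕ → Set} (P? : ∀ y → Dec (P y)) (Q? : ∀ y → Dec (Q y)) N → (∀ {y} → P y → Q y) →
                    prefixLength P? N ≤ prefixLength Q? N
prefixLength-mono P? Q? zero _ = z≤n
prefixLength-mono {P} {Q} P? Q? (suc N) P⇒Q with P? 0 | Q? 0
... | no _   | _      = z≤n
... | yes p0 | no ¬q0 = ⊥-elim (¬q0 (P⇒Q p0))
... | yes _  | yes _  =
  s≤s (prefixLength-mono {λ y → P (suc y)} {λ y → Q (suc y)} (λ y → P? (suc y)) (λ y → Q? (suc y)) N P⇒Q)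

-- The up-set {a ≥ θ} of an order preserving map, presented as a monotone column-height function.
module Threshold {n : ℕ} {a : Map} (a∈O : OrderPres n a) (θ : ℚ) where

  -- Points below row n count as high, so that the heights are monotone across columns.
  High : ℕ → ℕ → Set
  High j y = n < j + y ⊎ θ ≤ℚ a (j + y) j

  high? : ∀ j y → Dec (High j y)
  high? j y = (n <? j + y) ⊎-dec (θ ℚ.≤? a (j + y) j)

  level : ℕ → ℕ
  level zero    = 0
  level (suc j) = prefixLength (high? (suc j)) (suc n)

  level-monotone : StepMonotone level
  level-monotone zero    = z≤n
  level-monotone (suc m) =
    prefixLength-mono {High (suc m)} {High (suc (suc m))} (high? (suc m)) (high? (suc (suc m))) (suc n) next
    where
    next : ∀ {y} → High (suc m) y → High (suc (suc m)) y
    next {y} (inj₁ n<) = inj₁ (ℕ.<-trans n< (ℕ.n<1+n _))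
    next {y} (inj₂ θ≤) with n <? suc (suc m + y)
    ... | yes n< = inj₁ n<
    ... | no n≮  = inj₂ (ℚ.≤-trans θ≤ (a∈O _ _ _ _
        (s≤s z≤n , ℕ.m≤m+n (suc m) y , ℕ.≤-trans (ℕ.n≤1+n _) (ℕ.≮⇒≥ n≮))
        (s≤s z≤n , s≤s (ℕ.m≤m+n (suc m) y) , ℕ.≮⇒≥ n≮)
        (Leq-diag (suc m + y) (suc m))))

  Above-level⇔ : ∀ {i j} → InGT n i j → Above level (i , j) ⇔ θ ≤ℚ a i j
  Above-level⇔ {i} {suc j} (1≤j , j≤i , i≤n) with y , refl ← ℕ.m≤n⇒∃[o]m+o≡n j≤i = mk⇔
    (λ above → [ (λ n< → ⊥-elim (ℕ.<⇒≱ n< i≤n)) , id ]′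
                 (prefixLength-sound {High (suc j)} (high? (suc j)) (suc n) (shift⁻ above)))
    (λ θ≤ → shift (prefixLength-complete {High (suc j)} (high? (suc j)) y<1+n (inj₂ ∘ higher θ≤)))
    where
    L = level (suc j)
    y<1+n : y < suc n
    y<1+n = s≤s (ℕ.≤-trans (ℕ.m≤n+m y (suc j)) i≤n)
    higher : θ ≤ℚ a (suc j + y) (suc j) → ∀ {y′} → y′ ≤ y → θ ≤ℚ a (suc j + y′) (suc j)
    higher θ≤ y′≤y = ℚ.≤-trans θ≤ (a∈O _ _ _ _
      (1≤j , j≤i , i≤n)
      (1≤j , ℕ.m≤m+n (suc j) _ , ℕ.≤-trans (ℕ.+-monoʳ-≤ (suc j) y′≤y) i≤n)
      (Leq-column (suc j) (ℕ.+-monoʳ-≤ (suc j) y′≤y)))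
    shift : y < L → suc j + y < L + suc j
    shift lt = subst (suc j + y <_) (ℕ.+-comm (suc j) L) (ℕ.+-monoʳ-< (suc j) lt)
    shift⁻ : suc j + y < L + suc j → y < L
    shift⁻ lt = ℕ.+-cancelˡ-< (suc j) y L (subst (suc j + y <_) (ℕ.+-comm L (suc j)) lt)

threshold-cut : ∀ {n I a p} → All (Bad n) I → InQs n I a → Bad n p → ¬ InQ a p →
                CrossingCut I p
threshold-cut {n} {I} {a} {i₀ , j₀} I⊆bad (a∈O , a∈Qs) bad₀ a∉Q =
  record { height = level ; monotone = level-monotone ; avoids = All.zipWith avoid (I⊆bad , a∈Qs) } ,
  Equivalence.from (crosses-level⇔ bad₀) (a₀<θ , ℚ.≤-refl)
  where
  θ = a i₀ (suc j₀)
  open Threshold a∈O θ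
  crosses-level⇔ : ∀ {i j} → Bad n (i , j) → Crosses level (i , j) ⇔ (¬ θ ≤ℚ a i j × θ ≤ℚ a i (suc j))
  crosses-level⇔ bad = mk⇔
    (λ crosses → let (¬above , above′) = Equivalence.to (Crosses⇔ {level}) crosses in
       (λ θ≤ → ¬above (Equivalence.from here⇔ θ≤)) , Equivalence.to right⇔ above′)
    (λ (¬θ≤ , θ≤′) → Equivalence.from (Crosses⇔ {level})
       ((λ above → ¬θ≤ (Equivalence.to here⇔ above)) , Equivalence.from right⇔ θ≤′))
    where
    here⇔ = Above-level⇔ (bad⇒InGT bad)
    right⇔ = Above-level⇔ (bad⇒InGT-right bad)
  avoid : ∀ {q} → Bad n q × InQ a q → ¬ Crosses level q
  avoid (bad , eq) crosses = let (a<θ , θ≤a′) = Equivalence.to (crosses-level⇔ bad) crosses in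
    a<θ (subst (θ ≤ℚ_) (sym eq) θ≤a′)
  a₀<θ : ¬ a i₀ (suc j₀) ≤ℚ a i₀ j₀
  a₀<θ θ≤a₀ = a∉Q (ℚ.≤-antisym (a∈O _ _ _ _ (bad⇒InGT bad₀) (bad⇒InGT-right bad₀) (Leq-right i₀ j₀)) θ≤a₀)

∃-Vec? : ∀ {b} k {P : Vec (Fin b) k → Set} → (∀ v → Dec (P v)) → Dec (∃ P)
∃-Vec? zero    P? = map′ ([] ,_) (λ { ([] , p) → p }) (P? [])
∃-Vec? (suc k) P? = map′ (λ (x , v , p) → x ∷ v , p) (λ { (x ∷ v , p) → x , v , p })
                         (Fin.any? λ x → ∃-Vec? k (λ v → P? (x ∷ v)))

crosses? : ∀ g p → Dec (Crosses g p)
crosses? g (i , j) = (g j + j ≤? i) ×-dec (i ≤? g (suc j) + j)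

Crosses-cong : ∀ g h {i j} → g j ≡ h j → g (suc j) ≡ h (suc j) → Crosses g (i , j) → Crosses h (i , j)
Crosses-cong g h {i} {j} eq eq′ = subst₂ (λ x y → x + j ≤ i × i ≤ y + j) eq eq′

Crosses-capped : ∀ {n} g {i j} → i < n → Crosses g (i , j) ⇔ Crosses (λ m → g m ⊓ n) (i , j)
Crosses-capped {n} g {i} {j} i<n = mk⇔
  (λ (gj+j≤i , i≤g′+j) →
     ℕ.≤-trans (ℕ.+-monoˡ-≤ j (ℕ.m⊓n≤m (g j) n)) gj+j≤i ,
     ℕ.≤-trans (ℕ.⊓-glb i≤g′+j (ℕ.≤-trans (ℕ.<⇒≤ i<n) (ℕ.m≤m+n n j)))
               (ℕ.≤-reflexive (sym (ℕ.+-distribʳ-⊓ j (g (suc j)) n))))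
  (λ (capped≤i , i≤capped′) → uncap capped≤i , ℕ.≤-trans i≤capped′ (ℕ.+-monoˡ-≤ j (ℕ.m⊓n≤m _ n)))
  where
  uncap : g j ⊓ n + j ≤ i → g j + j ≤ i
  uncap le with ℕ.≤-total (g j) n
  ... | inj₁ gj≤n = subst (λ x → x + j ≤ i) (ℕ.m≤n⇒m⊓n≡m gj≤n) le
  ... | inj₂ n≤gj = ⊥-elim (ℕ.<⇒≱ i<n (ℕ.≤-trans (ℕ.m≤m+n n j)
                      (subst (λ x → x + j ≤ i) (ℕ.m≥n⇒m⊓n≡n n≤gj) le)))

-- Cuts through a bad point are searched for among height functions with values in {0,…,n},
-- encoded by their first n values.
module CutSearch {n : ℕ} {I : List Pt} (I⊆bad : All (Bad n) I) where

  decode : ∀ {k} → Vec (Fin (suc n)) k → ℕ → ℕ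
  decode []       _       = n
  decode (x ∷ _)  zero    = toℕ x
  decode (_ ∷ xs) (suc m) = decode xs m

  encode : (ℕ → ℕ) → ∀ k → Vec (Fin (suc n)) k
  encode g zero    = []
  encode g (suc k) = fromℕ< (s≤s (ℕ.m⊓n≤n (g 0) n)) ∷ encode (λ m → g (suc m)) k

  decode-≤ : ∀ {k} (xs : Vec (Fin (suc n)) k) m → decode xs m ≤ n
  decode-≤ []       _       = ℕ.≤-refl
  decode-≤ (x ∷ _)  zero    = ℕ.≤-pred (Fin.toℕ<n x)
  decode-≤ (_ ∷ xs) (suc m) = decode-≤ xs m

  decode-beyond : ∀ {k} (xs : Vec (Fin (suc n)) k) {m} → k ≤ m → decode xs m ≡ n
  decode-beyond []       _         = refl
  decode-beyond (_ ∷ xs) (s≤s k≤m) = decode-beyond xs k≤m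

  decode-encode : ∀ g k {m} → m < k → decode (encode g k) m ≡ g m ⊓ n
  decode-encode g (suc k) {zero}  _         = Fin.toℕ-fromℕ< (s≤s (ℕ.m⊓n≤n (g 0) n))
  decode-encode g (suc k) {suc m} (s≤s m<k) = decode-encode (λ m → g (suc m)) k m<k

  Ascending : Vec (Fin (suc n)) n → Set
  Ascending c = ∀ (m : Fin n) → decode c (toℕ m) ≤ decode c (suc (toℕ m))

  ascending⇒monotone : ∀ {c} → Ascending c → StepMonotone (decode c)
  ascending⇒monotone {c} asc m with suc m ≤? n
  ... | yes m<n = subst (λ x → decode c x ≤ decode c (suc x)) (Fin.toℕ-fromℕ< m<n) (asc (fromℕ< m<n))
  ... | no m≮n  = ℕ.≤-trans (decode-≤ c m) (ℕ.≤-reflexive (sym (decode-beyond c (ℕ.<⇒≤ (ℕ.≰⇒> m≮n)))))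

  encode-monotone : ∀ {g} → StepMonotone g → StepMonotone (decode (encode g n))
  encode-monotone {g} mono m with suc m <? n
  ... | yes 1+m<n = subst₂ _≤_ (sym (decode-encode g n (ℕ.<-trans (ℕ.n<1+n m) 1+m<n)))
                              (sym (decode-encode g n 1+m<n)) (ℕ.⊓-monoˡ-≤ n (mono m))
  ... | no 1+m≮n  = ℕ.≤-trans (decode-≤ (encode g n) m)
                      (ℕ.≤-reflexive (sym (decode-beyond (encode g n) (ℕ.≮⇒≥ 1+m≮n))))

  Valid : Pt → Vec (Fin (suc n)) n → Set
  Valid p c = Ascending c × All (λ q → ¬ Crosses (decode c) q) I × Crosses (decode c) p

  valid? : ∀ p c → Dec (Valid p c)
  valid? p c = Fin.all? (λ m → decode c (toℕ m) ≤? decode c (suc (toℕ m)))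
         ×-dec All.all? (λ q → ¬? (crosses? (decode c) q)) I
         ×-dec crosses? (decode c) p

  Crosses-encode : ∀ g {p} → Bad n p → Crosses g p ⇔ Crosses (decode (encode g n)) p
  Crosses-encode g {i , j} (_ , j<i , i<n) = mk⇔
    (λ crosses → Crosses-cong capped decoded (sym (decode-encode g n j<n)) (sym (decode-encode g n 1+j<n))
                   (Equivalence.to (Crosses-capped g i<n) crosses))
    (λ crosses → Equivalence.from (Crosses-capped g i<n)
                   (Crosses-cong decoded capped (decode-encode g n j<n) (decode-encode g n 1+j<n) crosses))
    where
    capped = λ m → g m ⊓ n
    decoded = decode (encode g n)
    1+j<n = ℕ.≤-<-trans j<i i<n
    j<n = ℕ.<-trans (ℕ.n<1+n _) 1+j<n

  crossingCut? : ∀ {p} → Bad n p → Dec (CrossingCut I p)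
  crossingCut? {p} bad = map′ fromCode toCode (∃-Vec? n (valid? p))
    where
    fromCode : ∃ (Valid p) → CrossingCut I p
    fromCode (c , asc , av , crosses) =
      record { height = decode c ; monotone = ascending⇒monotone {c} asc ; avoids = av } , crosses
    toCode : CrossingCut I p → ∃ (Valid p)
    toCode (cut , crosses) = encode (height cut) n ,
      (λ m → encode-monotone (monotone cut) (toℕ m)) ,
      All.zipWith (λ (bad , ¬crosses) → ¬crosses ∘ Equivalence.from (Crosses-encode (height cut) bad))
                  (I⊆bad , avoids cut) ,
      Equivalence.to (Crosses-encode (height cut) bad) crosses

-- Splicing cuts

CrossesBetween : ℕ → (ℕ → ℕ) → ℕ → ℕ → ℕ → Set
CrossesBetween n g j lo hi = ∀ {i} → Bad n (i , j) → lo ≤ i → i ≤ hi → Crosses g (i , j)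

splice : (ℕ → ℕ) → ℕ → (ℕ → ℕ) → ℕ → ℕ → ℕ
splice L v R s m with ℕ.<-cmp m s
... | tri< _ _ _ = L m
... | tri≈ _ _ _ = v
... | tri> _ _ _ = R m

module SpliceValues (L : ℕ → ℕ) (v : ℕ) (R : ℕ → ℕ) (s : ℕ) where

  splice-< : ∀ {m} → m < s → splice L v R s m ≡ L m
  splice-< {m} m<s with ℕ.<-cmp m s
  ... | tri< _ _ _    = refl
  ... | tri≈ m≮s _ _  = ⊥-elim (m≮s m<s)
  ... | tri> m≮s _ _  = ⊥-elim (m≮s m<s)

  splice-≡ : splice L v R s s ≡ v
  splice-≡ with ℕ.<-cmp s s
  ... | tri< s<s _ _ = ⊥-elim (ℕ.<-irrefl refl s<s)
  ... | tri≈ _ _ _   = refl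
  ... | tri> _ _ s<s = ⊥-elim (ℕ.<-irrefl refl s<s)

  splice-> : ∀ {m} → s < m → splice L v R s m ≡ R m
  splice-> {m} s<m with ℕ.<-cmp m s
  ... | tri< _ _ s≮m  = ⊥-elim (s≮m s<m)
  ... | tri≈ _ _ s≮m  = ⊥-elim (s≮m s<m)
  ... | tri> _ _ _    = refl

-- Gluing the columns < t + 1 of L, the value v in column t + 1 and the columns > t + 1 of R
-- gives a cut, provided the bad points of columns t and t + 1 that the glued cut crosses
-- are already crossed by L or by R.
module _ {n : ℕ} {I : List Pt} (I⊆bad : All (Bad n) I) where

  spliceCut : (L R : Cut I) (t v c : ℕ) →
    height L t ≤ v → v ≤ height R (2 + t) →
    CrossesBetween n (height L) t (height L t + t) (v + t) →
    CrossesBetween n (height L) (suc t) (v + suc t) c →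
    CrossesBetween n (height R) (suc t) (suc c) (height R (2 + t) + suc t) →
    Σ (Cut I) λ g → height g (suc t) ≡ v × height g (2 + t) ≡ height R (2 + t)
  spliceCut L R t v c Lt≤v v≤R crossᴸ crossᴸ′ crossᴿ =
    record { height = h ; monotone = mono ; avoids = All.tabulate avoid } ,
    splice-≡ , splice-> (ℕ.n<1+n (suc t))
    where
    s = suc t
    h = splice (height L) v (height R) s
    open SpliceValues (height L) v (height R) s
    mono : StepMonotone h
    mono m = by-position (ℕ.<-cmp m s)
      where
      by-position : Tri (m < s) (m ≡ s) (s < m) → h m ≤ h (suc m)
      by-position (tri> _ _ s<m) =
        subst₂ _≤_ (sym (splice-> s<m)) (sym (splice-> (ℕ.m<n⇒m<1+n s<m))) (monotone R m)
      by-position (tri≈ _ refl _) = subst₂ _≤_ (sym splice-≡) (sym (splice-> (ℕ.n<1+n s))) v≤R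
      by-position (tri< m<s _ _) with ℕ.m≤n⇒m<n∨m≡n m<s
      ... | inj₁ 1+m<s = subst₂ _≤_ (sym (splice-< m<s)) (sym (splice-< 1+m<s)) (monotone L m)
      ... | inj₂ refl  = subst₂ _≤_ (sym (splice-< m<s)) (sym splice-≡) Lt≤v
    avoid : ∀ {q} → q ∈ I → ¬ Crosses h q
    avoid {i , j} q∈I crosses = by-position (ℕ.<-cmp j s)
      where
      bad = All.lookup I⊆bad q∈I
      by-position : Tri (j < s) (j ≡ s) (s < j) → ⊥
      by-position (tri> _ _ s<j) = All.lookup (avoids R) q∈I
        (Crosses-cong h (height R) (splice-> s<j) (splice-> (ℕ.m<n⇒m<1+n s<j)) crosses)
      by-position (tri≈ _ refl _) with i ≤? c
      ... | yes i≤c = All.lookup (avoids L) q∈I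
                        (crossᴸ′ bad (subst (λ x → x + s ≤ i) splice-≡ (proj₁ crosses)) i≤c)
      ... | no i≰c  = All.lookup (avoids R) q∈I
                        (crossᴿ bad (ℕ.≰⇒> i≰c)
                                (subst (λ x → i ≤ x + s) (splice-> (ℕ.n<1+n s)) (proj₂ crosses)))
      by-position (tri< j<s _ _) with ℕ.m≤n⇒m<n∨m≡n j<s
      ... | inj₁ 1+j<s = All.lookup (avoids L) q∈I
                           (Crosses-cong h (height L) (splice-< j<s) (splice-< 1+j<s) crosses)
      ... | inj₂ refl  = All.lookup (avoids L) q∈I
                           (crossᴸ bad (subst (λ x → x + t ≤ i) (splice-< j<s) (proj₁ crosses))
                                       (subst (λ x → i ≤ x + t) splice-≡ (proj₂ crosses)))

emptyCut : ∀ {n I} → All (Bad n) I → Cut I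
emptyCut I⊆bad = record
  { height = λ _ → 0 ; monotone = λ _ → z≤n
  ; avoids = All.map (λ (_ , j<i , _) (_ , i≤j) → ℕ.<⇒≱ j<i i≤j) I⊆bad }

fullCut : ∀ {n I} → All (Bad n) I → Cut I
fullCut {n} I⊆bad = record
  { height = λ _ → n ; monotone = λ _ → ℕ.≤-refl
  ; avoids = All.map (λ { {_ , j} (_ , _ , i<n) (n+j≤i , _) → ℕ.<⇒≱ i<n (ℕ.≤-trans (ℕ.m≤m+n n j) n+j≤i) })
                     I⊆bad }

module _ {n : ℕ} {I : List Pt} (I⊆bad : All (Bad n) I) where

  -- The two halves of a separating cut: at a bad point a cut through it provides both,
  -- elsewhere the empty or the full cut does.
  LowerCut : Pt → Set
  LowerCut (i , j) = Σ (Cut I) λ c →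
    height c j + j ≤ i × CrossesBetween n (height c) j (height c j + j) i

  UpperCut : Pt → Set
  UpperCut (i , j) = Σ (Cut I) λ c →
    i ≤ height c (suc j) + j × CrossesBetween n (height c) j i (height c (suc j) + j)

  lowerCut : ∀ {i j} → j ≤ i → i < n → (Bad n (i , j) → CrossingCut I (i , j)) → LowerCut (i , j)
  lowerCut {i} {j} j≤i i<n crossing with bad? n (i , j)
  ... | yes bad = let (c , gj+j≤i , i≤g′+j) = crossing bad in
                  c , gj+j≤i , λ _ lo≤i′ i′≤i → lo≤i′ , ℕ.≤-trans i′≤i i≤g′+j
  ... | no ¬bad = emptyCut I⊆bad , j≤i ,
                  λ (1≤j , j<i′ , _) _ i′≤i → ⊥-elim (¬bad (1≤j , ℕ.<-≤-trans j<i′ i′≤i , i<n))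

  upperCut : ∀ {i j} → 1 ≤ j → j < i → i ≤ n → (Bad n (i , j) → CrossingCut I (i , j)) →
             UpperCut (i , j)
  upperCut {i} {j} 1≤j j<i i≤n crossing with bad? n (i , j)
  ... | yes bad = let (c , gj+j≤i , i≤g′+j) = crossing bad in
                  c , i≤g′+j , λ _ i≤i′ i′≤hi → ℕ.≤-trans gj+j≤i i≤i′ , i′≤hi
  ... | no ¬bad = fullCut I⊆bad , ℕ.≤-trans i≤n (ℕ.m≤m+n n j) ,
                  λ (_ , _ , i′<n) i≤i′ _ → ⊥-elim (¬bad (1≤j , j<i , ℕ.≤-<-trans i≤i′ i′<n))

  diagonal-separator : ∀ {i t} → LowerCut (i , suc t) → UpperCut (suc i , suc t) →
    Σ (Cut I) λ g → height g (suc t) + suc t ≤ i × suc i ≤ height g (2 + t) + suc t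
  diagonal-separator {i} {t} (L , Ls+s≤i , crossᴸ) (R , 1+i≤R′+s , crossᴿ) =
    let (g , g-s , g-s′) = spliceCut I⊆bad L R t (height L (suc t)) i (monotone L t) Ls≤R′
                             (λ _ lo≤ ≤hi → lo≤ , ≤hi) crossᴸ crossᴿ in
    g , subst (λ x → x + suc t ≤ i) (sym g-s) Ls+s≤i ,
        subst (λ x → suc i ≤ x + suc t) (sym g-s′) 1+i≤R′+s
    where
    Ls≤R′ : height L (suc t) ≤ height R (2 + t)
    Ls≤R′ = ℕ.+-cancelʳ-≤ (suc t) _ _ (ℕ.≤-trans Ls+s≤i (ℕ.≤-trans (ℕ.n≤1+n i) 1+i≤R′+s))

  up-separator : ∀ {k t} → t ≤ k → LowerCut (k , t) → UpperCut (suc k , suc t) →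
    Σ (Cut I) λ g → height g (suc t) + suc t ≡ suc k
  up-separator {k} {t} t≤k (L , Lt+t≤k , crossᴸ) (R , 1+k≤R′+s , crossᴿ) =
    let (g , g-s , _) = spliceCut I⊆bad L R t v k Lt≤v v≤R′
                          (subst (CrossesBetween n (height L) t (height L t + t)) (sym v+t≡k) crossᴸ)
                          (λ {i} _ 1+k≤i i≤k → ⊥-elim (ℕ.<⇒≱ (subst (_≤ i) v+s≡1+k 1+k≤i) i≤k))
                          crossᴿ in
    g , trans (cong (_+ suc t) g-s) v+s≡1+k
    where
    v = k ∸ t
    v+t≡k : v + t ≡ k
    v+t≡k = ℕ.m∸n+n≡m t≤k
    v+s≡1+k : v + suc t ≡ suc k
    v+s≡1+k = trans (ℕ.+-suc v t) (cong suc v+t≡k)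
    Lt≤v : height L t ≤ v
    Lt≤v = ℕ.+-cancelʳ-≤ t _ _ (ℕ.≤-trans Lt+t≤k (ℕ.≤-reflexive (sym v+t≡k)))
    v≤R′ : v ≤ height R (2 + t)
    v≤R′ = ℕ.+-cancelʳ-≤ (suc t) _ _ (ℕ.≤-trans (ℕ.≤-reflexive v+s≡1+k) 1+k≤R′+s)

-- Faces cut out by the Q_p

module Intersection {n : ℕ} {F : Map → Set} {I : List Pt}
                    (I⊆bad : All (Bad n) I) (F⇔Qs : ∀ a → F a ⇔ InQs n I a) where

  open CutSearch I⊆bad

  F⊆O : ∀ a → F a → OrderPres n a
  F⊆O a Fa = proj₁ (Equivalence.to (F⇔Qs a) Fa)

  cutMap∈F : (c : Cut I) → F (cutMap (height c))
  cutMap∈F c = Equivalence.from (F⇔Qs _) (cutMap∈Qs c)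

  Forced : Pt → Set
  Forced p = Bad n p × ¬ CrossingCut I p

  forced? : ∀ p → Dec (Forced p)
  forced? p with bad? n p
  ... | yes bad = map′ (bad ,_) proj₂ (¬? (crossingCut? bad))
  ... | no ¬bad = no (¬bad ∘ proj₁)

  D : List Pt
  D = filter forced? (points n)

  D⊆bad : All (Bad n) D
  D⊆bad = All.tabulate (λ p∈D → proj₁ (proj₂ (∈-filter⁻ forced? {xs = points n} p∈D)))

  D⊆Q : ∀ {p} → p ∈ D → ∀ a → F a → InQ a p
  D⊆Q {i , j} p∈D a Fa = decidable-stable (a i j ℚ.≟ a i (suc j)) λ a∉Q →
    let (bad , ¬crossing) = proj₂ (∈-filter⁻ forced? {xs = points n} p∈D) in
    ¬crossing (threshold-cut I⊆bad (Equivalence.to (F⇔Qs a) Fa) bad a∉Q)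

  crossingCut-∉D : ∀ {p} → Bad n p → ¬ p ∈ D → CrossingCut I p
  crossingCut-∉D bad p∉D with crossingCut? bad
  ... | yes crossing = crossing
  ... | no ¬crossing = ⊥-elim (p∉D (∈-filter⁺ forced? (InGT⇒∈points (bad⇒InGT bad)) (bad , ¬crossing)))

  -- An up edge ((k+1,t+1),(k,t+1)) lies on G_{k,t} and G_{k+1,t+1}, a diagonal edge
  -- ((i,t+1),(i+1,t+2)) on G_{i,t+1} and G_{i+1,t+1}.
  separating-cut : ∀ {e} → Cover n e → ¬ Any (λ p → Diamond p e) D →
                   Σ (Cut I) λ c → ¬ Flat (cutMap (height c)) e
  separating-cut {(_ , zero) , _} ((() , _) , _) _
  separating-cut {(suc k , suc t) , (k , _)} ((_ , _ , 1+k≤n) , (_ , 1+t≤k , _) , inj₁ (refl , refl)) off-D =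
    g , cutMap-separates (height g) {suc k} {suc t} {k} {suc t}
          (ℕ.<-irrefl (sym g-boundary)) (ℕ.≤-reflexive (sym g-boundary))
    where
    t≤k = ℕ.≤-trans (ℕ.n≤1+n t) 1+t≤k
    lower = lowerCut I⊆bad t≤k 1+k≤n
              (λ bad → crossingCut-∉D bad (λ p∈D → off-D (lose p∈D (inj₂ (inj₂ (inj₂ refl))))))
    upper = upperCut I⊆bad (s≤s z≤n) (s≤s 1+t≤k) 1+k≤n
              (λ bad → crossingCut-∉D bad (λ p∈D → off-D (lose p∈D (inj₁ refl))))
    separator = up-separator I⊆bad t≤k lower upper
    g = proj₁ separator
    g-boundary = proj₂ separator
  separating-cut {(i , suc t) , (_ , _)} ((_ , 1+t≤i , _) , (_ , _ , 1+i≤n) , inj₂ (refl , refl)) off-D =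
    g , cutMap-separates (height g) {i} {suc t} {suc i} {2 + t} (ℕ.≤⇒≯ gs+s≤i)
          (ℕ.≤-trans (s≤s 1+i≤g′+s) (ℕ.≤-reflexive (sym (ℕ.+-suc (height g (2 + t)) (suc t)))))
    where
    lower = lowerCut I⊆bad 1+t≤i 1+i≤n
              (λ bad → crossingCut-∉D bad (λ p∈D → off-D (lose p∈D (inj₂ (inj₁ refl)))))
    upper = upperCut I⊆bad (s≤s z≤n) (s≤s 1+t≤i) 1+i≤n
              (λ bad → crossingCut-∉D bad (λ p∈D → off-D (lose p∈D (inj₂ (inj₂ (inj₁ refl))))))
    separator = diagonal-separator I⊆bad lower upper
    g = proj₁ separator
    gs+s≤i = proj₁ (proj₂ separator)
    1+i≤g′+s = proj₂ (proj₂ separator)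

  G⇔⋃D : ∀ e → G n F e ⇔ (∃[ p ] (p ∈ D × Diamond p e))
  G⇔⋃D e = mk⇔
    (λ (c , flat) → find (decidable-stable (Any.any? (λ p → diamond? p e) D) λ off-D →
       let (g , ¬flat) = separating-cut c off-D in ¬flat (flat _ (cutMap∈F g))))
    (λ (p , p∈D , d) → InQ⇒diamond⊆G F⊆O (All.lookup D⊆bad p∈D) (D⊆Q p∈D) e d)

  G-closedDiamondPoset : IsClosedDiamondPoset n (G n F)
  G-closedDiamondPoset = (D , D⊆bad , G⇔⋃D) , G-closed F⊆O

diamondPoset⇒intersection : ∀ {n F} → IsFace n F → IsDiamondPoset n (G n F) →
  ∃[ I ] (All (Bad n) I × (∀ a → F a ⇔ InQs n I a))
diamondPoset⇒intersection {n} {F} face (D , D⊆bad , G⇔⋃D) = D , D⊆bad , λ a → mk⇔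
  (λ Fa → face⊆O a Fa ,
          All.tabulate (λ p∈D → diamond⊆G⇒InQ (λ e d → Equivalence.from (G⇔⋃D e) (_ , p∈D , d)) a Fa))
  (λ (a∈O , a∈Qs) → flat-on-G⇒∈F a∈O λ e e∈G →
     let (p , p∈D , d) = Equivalence.to (G⇔⋃D e) e∈G in
     diamond-flat a∈O (All.lookup D⊆bad p∈D) (All.lookup a∈Qs p∈D) d)
  where open Face face

lemma3p5 : (n : ℕ) → 1 ≤ n → (F : Map → Set) → IsFace n F → NonEmpty F →
    (∃[ I ] (All (Bad n) I × (∀ a → F a ⇔ InQs n I a))) ⇔ IsClosedDiamondPoset n (G n F)
lemma3p5 n _ F face _ = mk⇔
  (λ (I , I⊆bad , F⇔Qs) → Intersection.G-closedDiamondPoset I⊆bad F⇔Qs)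
  (λ (diamondPoset , _) → diamondPoset⇒intersection face diamondPoset)
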